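{- Let $3\leq n\leq m$. Then $$C_{M_n,M_m}(z) = C_{M_m,M_n}(z) = \sum_{b\in B_n\cap B_m} z^{|b|-1}.$$
   Context: Finite Fibonacci words: $f_1=1$, $f_2=0$, $f_{n+2}=f_{n+1}f_n$. For $n\geq 3$, $p_n$ is $f_n$ with its last two letters deleted ($p_3=\epsilon$, $p_4=0$, ...). The minimal forbidden factors of the infinite Fibonacci word are $M_{2n+1}=1p_{2n+1}1$ and $M_{2n+2}=0p_{2n+2}0$ for $n\geq 1$. A word $b$ is a border of $w$ if $w=xb=by$ for some words $x,y$; for $n\geq 3$, $B_n$ is the set of nonempty borders of $M_n$. Words are indexed from $0$. For $u$ of length $n$ and $v$ of length $m$, the correlation $C_{u,v}$ is the binary word of length $n$ with $C_{u,v}[k]=1$ iff $u[i]=v[j]$ for all $0\le i<n$, $0\le j<m$ with $i=j+k$ (and $0$ otherwise); its correlation polynomial is $C_{u,v}(z)=\sum_{k=0}^{n-1}C_{u,v}[k]z^{n-1-k}$. -}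

module Defs where

open import Data.Bool using (Bool; true; false; _∧_; _∨_; not; if_then_else_)
open import Data.Bool.Properties using () renaming (_≟_ to _≟B_)
open import Data.Nat using (ℕ; zero; suc; _+_; _∸_; _≡ᵇ_)
open import Data.List using (List; []; _∷_; _++_; take; drop; length; map; upTo; concatMap; filterᵇ)
open import Data.Bool.ListAction using (and; any)
open import Data.Nat.ListAction using (sum)
open import Data.List.Properties using (≡-dec)
open import Data.Maybe using (Maybe; just; nothing)
open import Relation.Nullary.Decidable using (⌊_⌋)

-- Words over the alphabet {0,1}; letter 0 is false, letter 1 is true.
Word : Set
Word = List Bool

_==w_ : Word → Word → Bool
u ==w v = ⌊ ≡-dec _≟B_ u v ⌋

-- Finite Fibonacci words: f_1 = 1, f_2 = 0, f_{n+2} = f_{n+1} f_n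
-- (f_0 is unused and set to the empty word).
fib : ℕ → Word
fib zero = []
fib (suc zero) = true ∷ []
fib (suc (suc zero)) = false ∷ []
fib (suc (suc (suc n))) = fib (suc (suc n)) ++ fib (suc n)

p : ℕ → Word
p n = take (length (fib n) ∸ 2) (fib n)

oddᵇ : ℕ → Bool
oddᵇ zero = false
oddᵇ (suc n) = not (oddᵇ n)

-- Minimal forbidden factors (n ≥ 3): M_n = 1 p_n 1 for n odd, 0 p_n 0 for n even.
M : ℕ → Word
M n = oddᵇ n ∷ (p n ++ (oddᵇ n ∷ []))

lookupM : Word → ℕ → Maybe Bool
lookupM [] _ = nothing
lookupM (x ∷ xs) zero = just x
lookupM (x ∷ xs) (suc i) = lookupM xs i

eqM : Maybe Bool → Maybe Bool → Bool
eqM (just a) (just b) = ⌊ a ≟B b ⌋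
eqM nothing nothing = true
eqM _ _ = false

corrBit : Word → Word → ℕ → Bool
corrBit u v k =
  and (map (λ i → and (map (λ j → not (i ≡ᵇ (j + k)) ∨ eqM (lookupM u i) (lookupM v j))
                           (upTo (length v))))
           (upTo (length u)))

-- Polynomials with natural-number coefficients, represented by their
-- coefficient sequence: P d = coefficient of z^d.
Poly : Set
Poly = ℕ → ℕ

corrPoly : Word → Word → Poly
corrPoly u v d =
  sum (map (λ k → if corrBit u v k ∧ ((length u ∸ 1 ∸ k) ≡ᵇ d) then 1 else 0)
           (upTo (length u)))

borders : Word → List Word
borders w =
  concatMap (λ L → if take (suc L) w ==w drop (length w ∸ suc L) w
                   then take (suc L) w ∷ []
                   else [])
            (upTo (length w))

B : ℕ → List Word
B n = borders (M n)

Bcap : ℕ → ℕ → List Word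
Bcap n m = filterᵇ (λ b → any (λ c → b ==w c) (B m)) (B n)

borderSumPoly : List Word → Poly
borderSumPoly S d = sum (map (λ b → if (length b ∸ 1) ≡ᵇ d then 1 else 0) S)

-- For n ≥ 3, M_n = x p_n x is a palindrome, and for n < m the word p_m begins with p_n x̄.
-- For palindromes u and v, the correlation bit of u and v at shift |u| - ℓ, like that of v and u
-- at shift |v| - ℓ, says that the length-ℓ prefix of u, reversed, is the length-ℓ prefix of v.
-- For u = M_n and v = M_m this cannot happen for ℓ = |M_n|, as the last letters x and x̄ differ,
-- and for shorter ℓ it forces the first letters of M_n and M_m to agree, so the mirrored prefix is
-- a common prefix and hence a common border. The remaining coefficients of C_{M_m,M_n} would record
-- an occurrence of M_n inside p_m, a factor of the Fibonacci word; desubstitution along the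
-- Fibonacci morphism 0 ↦ 01, 1 ↦ 0, which maps M_n to M_{n+1} up to an end letter, rules this out.

module Submission where

open import Defs
open import Data.Bool using (Bool; true; false; _∧_; _∨_; not; if_then_else_; T)
open import Data.Bool.Properties using (not-involutive; not-¬; T-∧; ∧-assoc)
open import Data.Bool.ListAction using (any; all)
open import Data.Empty using (⊥; ⊥-elim)
open import Data.List
  using (List; []; _∷_; _++_; _∷ʳ_; last; take; drop; length; map; upTo; applyUpTo; concatMap; filterᵇ; reverse)
open import Data.List.Properties
  using (map-++; map-upTo; length-++; length-take; length-drop; length-reverse; length-++-≤ˡ; length-++-≤ʳ;
         ++-assoc; ∷ʳ-++; ∷-injectiveˡ; ∷-injectiveʳ; ∷ʳ-injectiveʳ; take-all; take++drop≡id;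
         reverse-++; reverse-selfInverse; unfold-reverse)
open import Data.List.Relation.Unary.Any using (Any; here)
import Data.List.Relation.Unary.All.Properties as All
import Data.List.Relation.Unary.Any.Properties as Any
open import Data.Maybe using (just; nothing)
open import Data.Maybe.Properties using (just-injective)
open import Data.Nat using (ℕ; zero; suc; _+_; _∸_; _≡ᵇ_; _≤_; _<_; s≤s; z<s; s<s; s≤s⁻¹; _⊓_)
open import Data.Nat.ListAction using (sum)
open import Data.Nat.ListAction.Properties using (sum-++)
open import Data.Nat.Properties
open import Data.Product using (_×_; _,_; proj₁; ∃-syntax)
open import Data.Sum using (_⊎_; inj₁; inj₂)
open import Function using (id; _∘_; Equivalence)
open import Relation.Binary.PropositionalEquality
open import Relation.Nullary using (yes; no)
open import Relation.Nullary.Decidable using (toWitness; fromWitness)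

indicator : Bool → ℕ
indicator b = if b then 1 else 0

indicator-cong : ∀ {b c} → (T b → T c) → (T c → T b) → indicator b ≡ indicator c
indicator-cong {false} {false} _ _ = refl
indicator-cong {false} {true}  _ g = ⊥-elim (g _)
indicator-cong {true}  {false} f _ = ⊥-elim (f _)
indicator-cong {true}  {true}  _ _ = refl

T-not-∨⁺ : ∀ {b c} → (T b → T c) → T (not b ∨ c)
T-not-∨⁺ {false} _ = _
T-not-∨⁺ {true}  f = f _

T-not-∨⁻ : ∀ {b c} → T (not b ∨ c) → T b → T c
T-not-∨⁻ {true} t _ = t

sum-applyUpTo-≡0 : ∀ n (h : ℕ → ℕ) → (∀ {k} → k < n → h k ≡ 0) → sum (applyUpTo h n) ≡ 0
sum-applyUpTo-≡0 zero    h h≡0 = refl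
sum-applyUpTo-≡0 (suc n) h h≡0 =
  cong₂ _+_ (h≡0 z<s) (sum-applyUpTo-≡0 n (h ∘ suc) (h≡0 ∘ s<s))

sum-applyUpTo-single : ∀ n (h : ℕ → ℕ) {t} → t < n → (∀ {k} → k < n → k ≢ t → h k ≡ 0) →
                       sum (applyUpTo h n) ≡ h t
sum-applyUpTo-single (suc n) h {zero} _ h≡0 =
  trans (cong (h 0 +_) (sum-applyUpTo-≡0 n (h ∘ suc) (λ k<n → h≡0 (s<s k<n) λ ())))
        (+-identityʳ (h 0))
sum-applyUpTo-single (suc n) h {suc t} (s≤s t<n) h≡0 =
  cong₂ _+_ (h≡0 z<s λ ()) (sum-applyUpTo-single n (h ∘ suc) t<n
    (λ k<n k≢t → h≡0 (s<s k<n) (k≢t ∘ suc-injective)))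

T-all-upTo⁻ : ∀ n (g : ℕ → Bool) → T (all g (upTo n)) → ∀ {k} → k < n → T (g k)
T-all-upTo⁻ n g t = All.applyUpTo⁻ id n (All.all⁺ g (upTo n) t)

T-all-upTo⁺ : ∀ n (g : ℕ → Bool) → (∀ {k} → k < n → T (g k)) → T (all g (upTo n))
T-all-upTo⁺ n g t = All.all⁻ g (All.applyUpTo⁺₁ id n t)

eqM-sound : ∀ {x y} → T (eqM x y) → x ≡ y
eqM-sound {just _}  {just _}  t = cong just (toWitness t)
eqM-sound {nothing} {nothing} _ = refl

eqM-complete : ∀ {x y} → x ≡ y → T (eqM x y)
eqM-complete {just _}  refl = fromWitness refl
eqM-complete {nothing} refl = _

Overlap : Word → Word → ℕ → Set
Overlap u v k = ∀ {j} → j + k < length u → j < length v → lookupM u (j + k) ≡ lookupM v j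

corrBit⇒Overlap : ∀ u v k → T (corrBit u v k) → Overlap u v k
corrBit⇒Overlap u v k t {j} j+k<u j<v =
  eqM-sound (T-not-∨⁻ (T-all-upTo⁻ _ _ (T-all-upTo⁻ _ _ t j+k<u) j<v) (≡⇒≡ᵇ (j + k) (j + k) refl))

Overlap⇒corrBit : ∀ u v k → Overlap u v k → T (corrBit u v k)
Overlap⇒corrBit u v k ov =
  T-all-upTo⁺ _ _ λ i<u → T-all-upTo⁺ _ _ λ j<v → T-not-∨⁺ λ t →
    eqM-complete (aligned i<u j<v (≡ᵇ⇒≡ _ _ t))
  where
  aligned : ∀ {i j} → i < length u → j < length v → i ≡ j + k → lookupM u i ≡ lookupM v j
  aligned i<u j<v refl = ov i<u j<v

lookupM-take : ∀ (xs : Word) {n j} → j < n → lookupM (take n xs) j ≡ lookupM xs j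
lookupM-take []       {suc n} _         = refl
lookupM-take (x ∷ xs) {suc n} {zero}  _ = refl
lookupM-take (x ∷ xs) {suc n} {suc j} (s≤s j<n) = lookupM-take xs j<n

lookupM-drop : ∀ (xs : Word) k j → lookupM (drop k xs) j ≡ lookupM xs (k + j)
lookupM-drop xs       zero    j = refl
lookupM-drop []       (suc k) j = refl
lookupM-drop (x ∷ xs) (suc k) j = lookupM-drop xs k j

lookupM-ext : ∀ (xs ys : Word) → length xs ≡ length ys →
              (∀ {j} → j < length xs → lookupM xs j ≡ lookupM ys j) → xs ≡ ys
lookupM-ext []       []       _ _  = refl
lookupM-ext (x ∷ xs) (y ∷ ys) e at with at z<s
... | refl = cong (x ∷_) (lookupM-ext xs ys (suc-injective e) (at ∘ s<s))

m<n∸o⇒m+o<n : ∀ {j} n k → j < n ∸ k → j + k < n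
m<n∸o⇒m+o<n {j} n       zero    j<n = subst (_< n) (sym (+-identityʳ j)) j<n
m<n∸o⇒m+o<n {j} (suc n) (suc k) j<n = subst (_< suc n) (sym (+-suc j k)) (s<s (m<n∸o⇒m+o<n n k j<n))

Overlap⇒take-drop : ∀ u v k → Overlap u v k → take (length v) (drop k u) ≡ take (length u ∸ k) v
Overlap⇒take-drop u v k ov = lookupM-ext _ _ equal-lengths pointwise
  where
  window-length : length (take (length v) (drop k u)) ≡ length v ⊓ (length u ∸ k)
  window-length = trans (length-take (length v) (drop k u)) (cong (length v ⊓_) (length-drop k u))
  equal-lengths : length (take (length v) (drop k u)) ≡ length (take (length u ∸ k) v)
  equal-lengths = trans window-length (trans (⊓-comm (length v) _) (sym (length-take (length u ∸ k) v)))
  pointwise : ∀ {j} → j < length (take (length v) (drop k u)) →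
              lookupM (take (length v) (drop k u)) j ≡ lookupM (take (length u ∸ k) v) j
  pointwise {j} j<ℓ = begin
    lookupM (take (length v) (drop k u)) j ≡⟨ lookupM-take (drop k u) j<v ⟩
    lookupM (drop k u) j                   ≡⟨ lookupM-drop u k j ⟩
    lookupM u (k + j)                      ≡⟨ cong (lookupM u) (+-comm k j) ⟩
    lookupM u (j + k)                      ≡⟨ ov (m<n∸o⇒m+o<n (length u) k j<u∸k) j<v ⟩
    lookupM v j                            ≡⟨ lookupM-take v j<u∸k ⟨
    lookupM (take (length u ∸ k) v) j      ∎
    where
    open ≡-Reasoning
    j<⊓ : j < length v ⊓ (length u ∸ k)
    j<⊓ = subst (j <_) window-length j<ℓ
    j<v : j < length v
    j<v = m<n⊓o⇒m<n (length v) _ j<⊓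
    j<u∸k : j < length u ∸ k
    j<u∸k = m<n⊓o⇒m<o (length v) _ j<⊓

take-drop⇒Overlap : ∀ u v k → take (length v) (drop k u) ≡ take (length u ∸ k) v → Overlap u v k
take-drop⇒Overlap u v k eq {j} j+k<u j<v = begin
  lookupM u (j + k)                      ≡⟨ cong (lookupM u) (+-comm j k) ⟩
  lookupM u (k + j)                      ≡⟨ lookupM-drop u k j ⟨
  lookupM (drop k u) j                   ≡⟨ lookupM-take (drop k u) j<v ⟨
  lookupM (take (length v) (drop k u)) j ≡⟨ cong (λ w → lookupM w j) eq ⟩
  lookupM (take (length u ∸ k) v) j      ≡⟨ lookupM-take v (m+n≤o⇒m≤o∸n (suc j) j+k<u) ⟩
  lookupM v j                            ∎
  where open ≡-Reasoning

corrBit-sound : ∀ u v k → T (corrBit u v k) → take (length v) (drop k u) ≡ take (length u ∸ k) v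
corrBit-sound u v k = Overlap⇒take-drop u v k ∘ corrBit⇒Overlap u v k

corrBit-complete : ∀ u v k → take (length v) (drop k u) ≡ take (length u ∸ k) v → T (corrBit u v k)
corrBit-complete u v k = Overlap⇒corrBit u v k ∘ take-drop⇒Overlap u v k

indicator-∧-true : ∀ b {c} → T c → indicator (b ∧ c) ≡ indicator b
indicator-∧-true false _ = refl
indicator-∧-true true {true} _ = refl

indicator-∧-false : ∀ b {c} → (T c → ⊥) → indicator (b ∧ c) ≡ 0
indicator-∧-false false _ = refl
indicator-∧-false true {false} _ = refl
indicator-∧-false true {true} ¬c = ⊥-elim (¬c _)

∸-suc-< : ∀ {d n} → d < n → n ∸ suc d < n
∸-suc-< {d} {suc n} _ = s≤s (m∸n≤m n d)

∸-suc-involutive : ∀ {d n} → d < n → n ∸ suc (n ∸ suc d) ≡ d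
∸-suc-involutive (s≤s d≤n) = m∸[m∸n]≡n d≤n

∸-suc-injective : ∀ {d k n} → k < n → n ∸ suc k ≡ d → k ≡ n ∸ suc d
∸-suc-injective {n = suc n} (s≤s k≤n) refl = sym (m∸[m∸n]≡n k≤n)

∸-suc-≢ : ∀ {d k n} → k < n → n ≤ d → n ∸ suc k ≢ d
∸-suc-≢ {k = k} {suc n} _ n≤d refl = <-irrefl refl (≤-trans (s≤s (m∸n≤m n k)) n≤d)

corrPoly-term : Word → Word → ℕ → ℕ → ℕ
corrPoly-term u v d k = indicator (corrBit u v k ∧ ((length u ∸ 1 ∸ k) ≡ᵇ d))

corrPoly-applyUpTo : ∀ u v d → corrPoly u v d ≡ sum (applyUpTo (corrPoly-term u v d) (length u))
corrPoly-applyUpTo u v d = cong sum (map-upTo (corrPoly-term u v d) (length u))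

corrPoly-< : ∀ u v {d} → d < length u → corrPoly u v d ≡ indicator (corrBit u v (length u ∸ suc d))
corrPoly-< u v {d} d<u = begin
  corrPoly u v d                                     ≡⟨ corrPoly-applyUpTo u v d ⟩
  sum (applyUpTo (corrPoly-term u v d) (length u))   ≡⟨ sum-applyUpTo-single _ _ (∸-suc-< d<u) off-diagonal ⟩
  corrPoly-term u v d (length u ∸ suc d)             ≡⟨ indicator-∧-true _ (≡⇒≡ᵇ _ _ diagonal) ⟩
  indicator (corrBit u v (length u ∸ suc d))         ∎
  where
  open ≡-Reasoning
  diagonal : length u ∸ 1 ∸ (length u ∸ suc d) ≡ d
  diagonal = trans (∸-+-assoc (length u) 1 _) (∸-suc-involutive d<u)
  off-diagonal : ∀ {k} → k < length u → k ≢ length u ∸ suc d → corrPoly-term u v d k ≡ 0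
  off-diagonal k<u k≢ = indicator-∧-false _ λ t →
    k≢ (∸-suc-injective k<u (trans (sym (∸-+-assoc (length u) 1 _)) (≡ᵇ⇒≡ _ _ t)))

corrPoly-≥ : ∀ u v {d} → length u ≤ d → corrPoly u v d ≡ 0
corrPoly-≥ u v {d} u≤d = trans (corrPoly-applyUpTo u v d) (sum-applyUpTo-≡0 _ _ λ k<u →
  indicator-∧-false _ λ t → ∸-suc-≢ k<u u≤d (trans (sym (∸-+-assoc (length u) 1 _)) (≡ᵇ⇒≡ _ _ t)))

sum-applyUpTo-cong : ∀ n {f g : ℕ → ℕ} → (∀ {k} → k < n → f k ≡ g k) →
                     sum (applyUpTo f n) ≡ sum (applyUpTo g n)
sum-applyUpTo-cong zero    f≡g = refl
sum-applyUpTo-cong (suc n) f≡g = cong₂ _+_ (f≡g z<s) (sum-applyUpTo-cong n (f≡g ∘ s<s))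

sum-map-filterᵇ : ∀ {A : Set} (g : A → ℕ) (P : A → Bool) xs →
                  sum (map g (filterᵇ P xs)) ≡ sum (map (λ x → if P x then g x else 0) xs)
sum-map-filterᵇ g P []       = refl
sum-map-filterᵇ g P (x ∷ xs) with P x
... | true  = cong (g x +_) (sum-map-filterᵇ g P xs)
... | false = sum-map-filterᵇ g P xs

sum-map-concatMap : ∀ {A B : Set} (g : B → ℕ) (F : A → List B) xs →
                    sum (map g (concatMap F xs)) ≡ sum (map (sum ∘ map g ∘ F) xs)
sum-map-concatMap g F []       = refl
sum-map-concatMap g F (x ∷ xs) = begin
  sum (map g (F x ++ concatMap F xs))               ≡⟨ cong sum (map-++ g (F x) (concatMap F xs)) ⟩
  sum (map g (F x) ++ map g (concatMap F xs))       ≡⟨ sum-++ (map g (F x)) _ ⟩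
  sum (map g (F x)) + sum (map g (concatMap F xs))  ≡⟨ cong (sum (map g (F x)) +_) (sum-map-concatMap g F xs) ⟩
  sum (map g (F x)) + sum (map (sum ∘ map g ∘ F) xs) ∎
  where open ≡-Reasoning

sum-map-if : ∀ {A : Set} (g : A → ℕ) b x → sum (map g (if b then x ∷ [] else [])) ≡ (if b then g x else 0)
sum-map-if g false x = refl
sum-map-if g true  x = +-identityʳ (g x)

Any-if⁻ : ∀ {A : Set} {P : A → Set} b {x} → Any P (if b then x ∷ [] else []) → T b × P x
Any-if⁻ true (here px) = _ , px

Any-if⁺ : ∀ {A : Set} {P : A → Set} b {x} → T b → P x → Any P (if b then x ∷ [] else [])
Any-if⁺ true _ px = here px

length-take-≤ : ∀ (w : Word) {ℓ} → ℓ ≤ length w → length (take ℓ w) ≡ ℓ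
length-take-≤ w {ℓ} ℓ≤w = trans (length-take ℓ w) (m≤n⇒m⊓n≡m ℓ≤w)

isBorderᵇ : Word → ℕ → Bool
isBorderᵇ w L = take (suc L) w ==w drop (length w ∸ suc L) w

IsBorder : Word → ℕ → Set
IsBorder w ℓ = take ℓ w ≡ drop (length w ∸ ℓ) w

borderOfLength : Word → ℕ → List Word
borderOfLength w L = if isBorderᵇ w L then take (suc L) w ∷ [] else []

∈borders⁻ : ∀ v b → T (any (b ==w_) (borders v)) →
            ∃[ L ] L < length v × T (isBorderᵇ v L) × b ≡ take (suc L) v
∈borders⁻ v b t =
  let L , L<v , p = Any.applyUpTo⁻ id (Any.concatMap⁻ (borderOfLength v) (Any.any⁻ _ _ t))
      isB , b≡ = Any-if⁻ (isBorderᵇ v L) p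
  in L , L<v , isB , toWitness b≡

∈borders⁺ : ∀ v b {L} → L < length v → T (isBorderᵇ v L) → b ≡ take (suc L) v →
            T (any (b ==w_) (borders v))
∈borders⁺ v b {L} L<v isB b≡ =
  Any.any⁺ _ (Any.concatMap⁺ (borderOfLength v)
    (Any.applyUpTo⁺ id (Any-if⁺ (isBorderᵇ v L) isB (fromWitness b≡)) L<v))

-- Bcap n m unfolds to commonBorders (M n) (M m).
commonBorders : Word → Word → List Word
commonBorders u v = filterᵇ (λ b → any (b ==w_) (borders v)) (borders u)

commonBorderᵇ : Word → Word → ℕ → Bool
commonBorderᵇ u v L = isBorderᵇ u L ∧ any (take (suc L) u ==w_) (borders v)

CommonBorder : Word → Word → ℕ → Set
CommonBorder u v ℓ = IsBorder u ℓ × IsBorder v ℓ × take ℓ u ≡ take ℓ v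

commonBorderᵇ-sound : ∀ u v {d} → d < length u → d < length v →
                      T (commonBorderᵇ u v d) → CommonBorder u v (suc d)
commonBorderᵇ-sound u v {d} d<u d<v t with T-∧ {isBorderᵇ u d} .Equivalence.to t
... | isBu , inV with ∈borders⁻ v _ inV
... | L , L<v , isBv , u≡v
  with suc-injective (trans (sym (length-take-≤ u d<u)) (trans (cong length u≡v) (length-take-≤ v L<v)))
... | refl = toWitness isBu , toWitness isBv , u≡v

commonBorderᵇ-complete : ∀ u v {d} → d < length v → CommonBorder u v (suc d) → T (commonBorderᵇ u v d)
commonBorderᵇ-complete u v d<v (isBu , isBv , u≡v) =
  T-∧ .Equivalence.from (fromWitness isBu , ∈borders⁺ v _ d<v (fromWitness isBv) u≡v)

if-indicator : ∀ b c → (if b then indicator c else 0) ≡ indicator (b ∧ c)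
if-indicator false c = refl
if-indicator true  c = refl

borderSumPoly-applyUpTo : ∀ u v d → borderSumPoly (commonBorders u v) d ≡
                          sum (applyUpTo (λ L → indicator (commonBorderᵇ u v L ∧ (L ≡ᵇ d))) (length u))
borderSumPoly-applyUpTo u v d = begin
  borderSumPoly (commonBorders u v) d                  ≡⟨ sum-map-filterᵇ lengthIs inV (borders u) ⟩
  sum (map term (borders u))                           ≡⟨ sum-map-concatMap term (borderOfLength u) (upTo (length u)) ⟩
  sum (map (sum ∘ map term ∘ borderOfLength u) (upTo (length u))) ≡⟨ cong sum (map-upTo _ (length u)) ⟩
  sum (applyUpTo (sum ∘ map term ∘ borderOfLength u) (length u))  ≡⟨ sum-applyUpTo-cong (length u) term-at ⟩
  sum (applyUpTo (λ L → indicator (commonBorderᵇ u v L ∧ (L ≡ᵇ d))) (length u)) ∎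
  where
  open ≡-Reasoning
  lengthIsᵇ : Word → Bool
  lengthIsᵇ b = (length b ∸ 1) ≡ᵇ d
  lengthIs : Word → ℕ
  lengthIs = indicator ∘ lengthIsᵇ
  inV : Word → Bool
  inV b = any (b ==w_) (borders v)
  term : Word → ℕ
  term b = if inV b then lengthIs b else 0
  term-at : ∀ {L} → L < length u →
            sum (map term (borderOfLength u L)) ≡ indicator (commonBorderᵇ u v L ∧ (L ≡ᵇ d))
  term-at {L} L<u = begin
    sum (map term (borderOfLength u L))                 ≡⟨ sum-map-if term border x ⟩
    (if border then term x else 0)                      ≡⟨ cong (λ n → if border then n else 0) (if-indicator (inV x) _) ⟩
    (if border then indicator (inV x ∧ lengthIsᵇ x) else 0) ≡⟨ if-indicator border _ ⟩
    indicator (border ∧ (inV x ∧ lengthIsᵇ x))          ≡⟨ cong indicator (∧-assoc border (inV x) _) ⟨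
    indicator (commonBorderᵇ u v L ∧ lengthIsᵇ x)
      ≡⟨ cong (λ n → indicator (commonBorderᵇ u v L ∧ ((n ∸ 1) ≡ᵇ d))) (length-take-≤ u L<u) ⟩
    indicator (commonBorderᵇ u v L ∧ (L ≡ᵇ d))          ∎
    where
    x : Word
    x = take (suc L) u
    border : Bool
    border = isBorderᵇ u L

borderSumPoly-< : ∀ u v {d} → d < length u →
                  borderSumPoly (commonBorders u v) d ≡ indicator (commonBorderᵇ u v d)
borderSumPoly-< u v {d} d<u = begin
  borderSumPoly (commonBorders u v) d ≡⟨ borderSumPoly-applyUpTo u v d ⟩
  _                                   ≡⟨ sum-applyUpTo-single _ _ d<u off-diagonal ⟩
  indicator (commonBorderᵇ u v d ∧ (d ≡ᵇ d)) ≡⟨ indicator-∧-true _ (≡⇒≡ᵇ d d refl) ⟩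
  indicator (commonBorderᵇ u v d)     ∎
  where
  open ≡-Reasoning
  off-diagonal : ∀ {L} → L < length u → L ≢ d → indicator (commonBorderᵇ u v L ∧ (L ≡ᵇ d)) ≡ 0
  off-diagonal _ L≢d = indicator-∧-false _ (L≢d ∘ ≡ᵇ⇒≡ _ _)

borderSumPoly-≥ : ∀ u v {d} → length u ≤ d → borderSumPoly (commonBorders u v) d ≡ 0
borderSumPoly-≥ u v {d} u≤d = trans (borderSumPoly-applyUpTo u v d) (sum-applyUpTo-≡0 _ _ λ L<u →
  indicator-∧-false _ λ t → <-irrefl (≡ᵇ⇒≡ _ _ t) (<-≤-trans L<u u≤d))

-- Correlation of palindromes

IsPalindrome : Word → Set
IsPalindrome w = reverse w ≡ w

Mirrored : Word → Word → ℕ → Set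
Mirrored u v ℓ = reverse (take ℓ u) ≡ take ℓ v

NoEarlyOccurrence : Word → Word → Set
NoEarlyOccurrence u v = ∀ k → k + length u < length v → take (length u) (drop k v) ≢ u

CorrelationsMatchCommonBorders : Word → Word → Set
CorrelationsMatchCommonBorders u v =
  ((d : ℕ) → corrPoly u v d ≡ borderSumPoly (commonBorders u v) d) ×
  ((d : ℕ) → corrPoly v u d ≡ borderSumPoly (commonBorders u v) d)

take-++-≤ : ∀ {n} (xs ys : Word) → n ≤ length xs → take n (xs ++ ys) ≡ take n xs
take-++-≤ {zero}  _        _  _          = refl
take-++-≤ {suc n} (x ∷ xs) ys (s≤s n≤xs) = cong (x ∷_) (take-++-≤ xs ys n≤xs)

length-drop-∸ : ∀ (w : Word) {ℓ} → ℓ ≤ length w → length (drop (length w ∸ ℓ) w) ≡ ℓ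
length-drop-∸ w {ℓ} ℓ≤w = trans (length-drop (length w ∸ ℓ) w) (m∸[m∸n]≡n ℓ≤w)

palindrome-suffix : ∀ w {ℓ} → IsPalindrome w → ℓ ≤ length w →
                    drop (length w ∸ ℓ) w ≡ reverse (take ℓ w)
palindrome-suffix w {ℓ} w-pal ℓ≤w = sym (reverse-selfInverse (sym prefix))
  where
  open ≡-Reasoning
  s : ℕ
  s = length w ∸ ℓ
  length-suffix : length (reverse (drop s w)) ≡ ℓ
  length-suffix = trans (length-reverse (drop s w)) (length-drop-∸ w ℓ≤w)
  prefix : take ℓ w ≡ reverse (drop s w)
  prefix = begin
    take ℓ w                                          ≡⟨ cong (take ℓ) w-pal ⟨
    take ℓ (reverse w)                                ≡⟨ cong (take ℓ ∘ reverse) (take++drop≡id s w) ⟨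
    take ℓ (reverse (take s w ++ drop s w))           ≡⟨ cong (take ℓ) (reverse-++ (take s w) (drop s w)) ⟩
    take ℓ (reverse (drop s w) ++ reverse (take s w)) ≡⟨ take-++-≤ _ _ (≤-reflexive (sym length-suffix)) ⟩
    take ℓ (reverse (drop s w))                       ≡⟨ take-all ℓ _ (≤-reflexive length-suffix) ⟩
    reverse (drop s w)                                ∎

module _ (u v : Word) {ℓ} (ℓ≤u : ℓ ≤ length u) (ℓ≤v : ℓ ≤ length v) where

  private
    take-suffix : take (length v) (drop (length u ∸ ℓ) u) ≡ drop (length u ∸ ℓ) u
    take-suffix = take-all (length v) _ (≤-trans (≤-reflexive (length-drop-∸ u ℓ≤u)) ℓ≤v)

    take-prefix : take (length u ∸ (length u ∸ ℓ)) v ≡ take ℓ v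
    take-prefix = cong (λ n → take n v) (m∸[m∸n]≡n ℓ≤u)

  corrBit-suffix⁻ : T (corrBit u v (length u ∸ ℓ)) → drop (length u ∸ ℓ) u ≡ take ℓ v
  corrBit-suffix⁻ t = trans (sym take-suffix) (trans (corrBit-sound u v _ t) take-prefix)

  corrBit-suffix⁺ : drop (length u ∸ ℓ) u ≡ take ℓ v → T (corrBit u v (length u ∸ ℓ))
  corrBit-suffix⁺ eq = corrBit-complete u v _ (trans take-suffix (trans eq (sym take-prefix)))

module _ {u v : Word} (u-pal : IsPalindrome u) (v-pal : IsPalindrome v)
         {ℓ} (ℓ≤u : ℓ ≤ length u) (ℓ≤v : ℓ ≤ length v) where

  corrBit⇒Mirrored : T (corrBit u v (length u ∸ ℓ)) → Mirrored u v ℓ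
  corrBit⇒Mirrored t = trans (sym (palindrome-suffix u u-pal ℓ≤u)) (corrBit-suffix⁻ u v ℓ≤u ℓ≤v t)

  Mirrored⇒corrBit : Mirrored u v ℓ → T (corrBit u v (length u ∸ ℓ))
  Mirrored⇒corrBit m = corrBit-suffix⁺ u v ℓ≤u ℓ≤v (trans (palindrome-suffix u u-pal ℓ≤u) m)

  corrBitᵒ⇒Mirrored : T (corrBit v u (length v ∸ ℓ)) → Mirrored u v ℓ
  corrBitᵒ⇒Mirrored t =
    reverse-selfInverse (trans (sym (palindrome-suffix v v-pal ℓ≤v)) (corrBit-suffix⁻ v u ℓ≤v ℓ≤u t))

  Mirrored⇒corrBitᵒ : Mirrored u v ℓ → T (corrBit v u (length v ∸ ℓ))
  Mirrored⇒corrBitᵒ m =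
    corrBit-suffix⁺ v u ℓ≤v ℓ≤u (trans (palindrome-suffix v v-pal ℓ≤v) (reverse-selfInverse m))

  CommonBorder⇒Mirrored : CommonBorder u v ℓ → Mirrored u v ℓ
  CommonBorder⇒Mirrored (u-border , _ , u≡v) =
    trans (sym (palindrome-suffix u u-pal ℓ≤u)) (trans (sym u-border) u≡v)

  Mirrored⇒CommonBorder : take ℓ u ≡ take ℓ v → Mirrored u v ℓ → CommonBorder u v ℓ
  Mirrored⇒CommonBorder u≡v m = u-border , v-border , u≡v
    where
    u-border : IsBorder u ℓ
    u-border = trans u≡v (trans (sym m) (sym (palindrome-suffix u u-pal ℓ≤u)))
    v-border : IsBorder v ℓ
    v-border = trans (sym u≡v) (trans (sym (reverse-selfInverse m)) (sym (palindrome-suffix v v-pal ℓ≤v)))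

corrPoly-no-early-occurrence : ∀ u v {d} → NoEarlyOccurrence u v → length u ≤ d → corrPoly v u d ≡ 0
corrPoly-no-early-occurrence u v {d} no-early u≤d with d <? length v
... | no d≮v = corrPoly-≥ v u (≮⇒≥ d≮v)
... | yes d<v = trans (corrPoly-< v u d<v) (indicator-cong {c = false} occurrence λ ())
  where
  k : ℕ
  k = length v ∸ suc d
  early : k + length u < length v
  early = begin-strict
    k + length u ≤⟨ +-monoʳ-≤ k u≤d ⟩
    k + d        <⟨ +-monoʳ-< k (n<1+n d) ⟩
    k + suc d    ≡⟨ m∸n+n≡m d<v ⟩
    length v     ∎
    where open ≤-Reasoning
  occurrence : T (corrBit v u k) → ⊥
  occurrence t = no-early k early (trans (corrBit-sound v u k t) (begin
    take (length v ∸ k) u ≡⟨ cong (λ n → take n u) (m∸[m∸n]≡n d<v) ⟩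
    take (suc d) u        ≡⟨ take-all (suc d) u (m≤n⇒m≤1+n u≤d) ⟩
    u                     ∎))
    where open ≡-Reasoning

palindrome-correlation : ∀ {u v} → IsPalindrome u → IsPalindrome v → length u ≤ length v →
                         (∀ {ℓ} → ℓ ≤ length u → Mirrored u v ℓ → take ℓ u ≡ take ℓ v) →
                         NoEarlyOccurrence u v → CorrelationsMatchCommonBorders u v
palindrome-correlation {u} {v} u-pal v-pal u≤v mirrored⇒equal no-early = correlation , correlationᵒ
  where
  coefficient : ∀ {d b} → d < length u → (T b → Mirrored u v (suc d)) → (Mirrored u v (suc d) → T b) →
                indicator b ≡ borderSumPoly (commonBorders u v) d
  coefficient {d} d<u to from =
    trans (indicator-cong (Mirrored⇒commonBorderᵇ ∘ to) (from ∘ commonBorderᵇ⇒Mirrored))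
          (sym (borderSumPoly-< u v d<u))
    where
    d<v : d < length v
    d<v = <-≤-trans d<u u≤v
    commonBorderᵇ⇒Mirrored : T (commonBorderᵇ u v d) → Mirrored u v (suc d)
    commonBorderᵇ⇒Mirrored = CommonBorder⇒Mirrored u-pal v-pal d<u d<v ∘ commonBorderᵇ-sound u v d<u d<v
    Mirrored⇒commonBorderᵇ : Mirrored u v (suc d) → T (commonBorderᵇ u v d)
    Mirrored⇒commonBorderᵇ m =
      commonBorderᵇ-complete u v d<v (Mirrored⇒CommonBorder u-pal v-pal d<u d<v (mirrored⇒equal d<u m) m)

  correlation : ∀ d → corrPoly u v d ≡ borderSumPoly (commonBorders u v) d
  correlation d with d <? length u
  ... | yes d<u = trans (corrPoly-< u v d<u)
          (coefficient d<u (corrBit⇒Mirrored u-pal v-pal d<u d<v) (Mirrored⇒corrBit u-pal v-pal d<u d<v))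
    where
    d<v : d < length v
    d<v = <-≤-trans d<u u≤v
  ... | no d≮u = trans (corrPoly-≥ u v (≮⇒≥ d≮u)) (sym (borderSumPoly-≥ u v (≮⇒≥ d≮u)))

  correlationᵒ : ∀ d → corrPoly v u d ≡ borderSumPoly (commonBorders u v) d
  correlationᵒ d with d <? length u
  ... | yes d<u = trans (corrPoly-< v u d<v)
          (coefficient d<u (corrBitᵒ⇒Mirrored u-pal v-pal d<u d<v) (Mirrored⇒corrBitᵒ u-pal v-pal d<u d<v))
    where
    d<v : d < length v
    d<v = <-≤-trans d<u u≤v
  ... | no d≮u =
    trans (corrPoly-no-early-occurrence u v no-early (≮⇒≥ d≮u)) (sym (borderSumPoly-≥ u v (≮⇒≥ d≮u)))

-- The Fibonacci morphism and central words

φ : Word → Word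
φ []          = []
φ (false ∷ w) = false ∷ true ∷ φ w
φ (true ∷ w)  = false ∷ φ w

φ-++ : ∀ x y → φ (x ++ y) ≡ φ x ++ φ y
φ-++ []          y = refl
φ-++ (false ∷ x) y = cong (λ w → false ∷ true ∷ w) (φ-++ x y)
φ-++ (true ∷ x)  y = cong (false ∷_) (φ-++ x y)

φ-x∷not-x : ∀ x w → φ (x ∷ not x ∷ w) ≡ false ∷ not x ∷ not (not x) ∷ φ w
φ-x∷not-x false w = refl
φ-x∷not-x true  w = refl

φ-not-x∷x : ∀ x w → φ (not x ∷ x ∷ w) ≡ false ∷ not (not x) ∷ not x ∷ φ w
φ-not-x∷x false w = refl
φ-not-x∷x true  w = refl

fib-φ : ∀ m → fib (2 + m) ≡ φ (fib (1 + m))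
fib-φ zero          = refl
fib-φ (suc zero)    = refl
fib-φ (suc (suc m)) =
  trans (cong₂ _++_ (fib-φ (suc m)) (fib-φ m)) (sym (φ-++ (fib (2 + m)) (fib (1 + m))))

letter : ℕ → Bool
letter k = oddᵇ (3 + k)

-- central k is the paper's p_{k+3}; the recursion p_{n+1} = φ(p_n) 0 comes from f_{n+1} = φ(f_n).
central : ℕ → Word
central zero    = []
central (suc k) = φ (central k) ∷ʳ false

bracket : Bool → Word → Word
bracket x q = x ∷ (q ∷ʳ x)

fib≡central : ∀ k → fib (3 + k) ≡ central k ++ not (letter k) ∷ letter k ∷ []
fib≡central zero    = refl
fib≡central (suc k) = begin
  fib (4 + k)                                           ≡⟨ fib-φ (2 + k) ⟩
  φ (fib (3 + k))                                       ≡⟨ cong φ (fib≡central k) ⟩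
  φ (central k ++ not x ∷ x ∷ [])                       ≡⟨ φ-++ (central k) _ ⟩
  φ (central k) ++ φ (not x ∷ x ∷ [])                   ≡⟨ cong (φ (central k) ++_) (φ-not-x∷x x []) ⟩
  φ (central k) ++ false ∷ not (not x) ∷ not x ∷ []     ≡⟨ ∷ʳ-++ (φ (central k)) false _ ⟨
  central (suc k) ++ not (not x) ∷ not x ∷ []           ∎
  where
  open ≡-Reasoning
  x : Bool
  x = letter k

p≡central : ∀ k → p (3 + k) ≡ central k
p≡central k = begin
  p (3 + k)                          ≡⟨ cong (λ w → take (length w ∸ 2) w) (fib≡central k) ⟩
  take (length w ∸ 2) w              ≡⟨ cong (λ n → take (n ∸ 2) w) (length-++ (central k)) ⟩
  take (length (central k) + 2 ∸ 2) w ≡⟨ cong (λ n → take n w) (m+n∸n≡m _ 2) ⟩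
  take (length (central k)) w        ≡⟨ take-++-≤ (central k) _ ≤-refl ⟩
  take (length (central k)) (central k) ≡⟨ take-all _ (central k) ≤-refl ⟩
  central k                          ∎
  where
  open ≡-Reasoning
  w : Word
  w = central k ++ not (letter k) ∷ letter k ∷ []

M≡bracket : ∀ k → M (3 + k) ≡ bracket (letter k) (central k)
M≡bracket k = cong (bracket (letter k)) (p≡central k)

∷ʳ-++-∷ʳ : ∀ (xs ys : Word) y z → (xs ++ y ∷ ys) ∷ʳ z ≡ (xs ∷ʳ y) ++ (ys ∷ʳ z)
∷ʳ-++-∷ʳ xs ys y z = trans (++-assoc xs (y ∷ ys) (z ∷ [])) (sym (++-assoc xs (y ∷ []) (ys ∷ʳ z)))

φ∷ʳ-split : ∀ (xs ys : Word) {a b a′ b′} → φ (a ∷ b ∷ ys) ≡ false ∷ a′ ∷ b′ ∷ φ ys →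
            φ (xs ++ a ∷ b ∷ ys) ∷ʳ false ≡ (φ xs ∷ʳ false) ++ a′ ∷ b′ ∷ (φ ys ∷ʳ false)
φ∷ʳ-split xs ys {a} {b} {a′} {b′} φ-pair = begin
  φ (xs ++ a ∷ b ∷ ys) ∷ʳ false              ≡⟨ cong (_∷ʳ false) (φ-++ xs _) ⟩
  (φ xs ++ φ (a ∷ b ∷ ys)) ∷ʳ false          ≡⟨ cong (λ w → (φ xs ++ w) ∷ʳ false) φ-pair ⟩
  (φ xs ++ false ∷ a′ ∷ b′ ∷ φ ys) ∷ʳ false  ≡⟨ ∷ʳ-++-∷ʳ (φ xs) _ false false ⟩
  (φ xs ∷ʳ false) ++ a′ ∷ b′ ∷ (φ ys ∷ʳ false) ∎
  where open ≡-Reasoning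

central-suc-suc : ∀ k → central (2 + k) ≡ central (1 + k) ++ letter k ∷ not (letter k) ∷ central k
central-suc-suc zero    = refl
central-suc-suc (suc k) = trans (cong (λ w → φ w ∷ʳ false) (central-suc-suc k))
  (φ∷ʳ-split (central (1 + k)) (central k) (φ-x∷not-x (letter k) (central k)))

central-suc-sucᵒ : ∀ k → central (2 + k) ≡ central k ++ not (letter k) ∷ letter k ∷ central (1 + k)
central-suc-sucᵒ zero    = refl
central-suc-sucᵒ (suc k) = trans (cong (λ w → φ w ∷ʳ false) (central-suc-sucᵒ k))
  (φ∷ʳ-split (central k) (central (1 + k)) (φ-not-x∷x (letter k) (central (1 + k))))

reverse-++-∷-∷ : ∀ (xs ys : Word) x y → reverse (xs ++ x ∷ y ∷ ys) ≡ reverse ys ++ y ∷ x ∷ reverse xs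
reverse-++-∷-∷ xs ys x y = begin
  reverse (xs ++ x ∷ y ∷ ys)                    ≡⟨ reverse-++ xs (x ∷ y ∷ ys) ⟩
  reverse (x ∷ y ∷ ys) ++ reverse xs            ≡⟨ cong (_++ reverse xs) (reverse-++ (x ∷ y ∷ []) ys) ⟩
  (reverse ys ++ y ∷ x ∷ []) ++ reverse xs      ≡⟨ ++-assoc (reverse ys) (y ∷ x ∷ []) (reverse xs) ⟩
  reverse ys ++ y ∷ x ∷ reverse xs              ∎
  where open ≡-Reasoning

central-palindrome : ∀ k → IsPalindrome (central k) × IsPalindrome (central (suc k))
central-palindrome zero    = refl , refl
central-palindrome (suc k) with central-palindrome k
... | pal , pal-suc = pal-suc , (begin
  reverse (central (2 + k))                                    ≡⟨ cong reverse (central-suc-suc k) ⟩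
  reverse (central (1 + k) ++ x ∷ not x ∷ central k)           ≡⟨ reverse-++-∷-∷ (central (1 + k)) (central k) x (not x) ⟩
  reverse (central k) ++ not x ∷ x ∷ reverse (central (1 + k)) ≡⟨ cong₂ (λ a b → a ++ not x ∷ x ∷ b) pal pal-suc ⟩
  central k ++ not x ∷ x ∷ central (1 + k)                     ≡⟨ central-suc-sucᵒ k ⟨
  central (2 + k)                                              ∎)
  where
  open ≡-Reasoning
  x : Bool
  x = letter k

bracket-palindrome : ∀ x {q} → IsPalindrome q → IsPalindrome (bracket x q)
bracket-palindrome x {q} pal = begin
  reverse (x ∷ (q ∷ʳ x))   ≡⟨ unfold-reverse x (q ∷ʳ x) ⟩
  reverse (q ∷ʳ x) ∷ʳ x    ≡⟨ cong (_∷ʳ x) (reverse-++ q (x ∷ [])) ⟩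
  (x ∷ reverse q) ∷ʳ x     ≡⟨ cong (λ w → (x ∷ w) ∷ʳ x) pal ⟩
  x ∷ (q ∷ʳ x)             ∎
  where open ≡-Reasoning

central-prefix-suc : ∀ k → ∃[ r ] central (suc k) ≡ central k ++ not (letter k) ∷ r
central-prefix-suc zero    = [] , refl
central-prefix-suc (suc k) = not (letter k) ∷ central k ,
  trans (central-suc-suc k)
        (cong (λ c → central (1 + k) ++ c ∷ not (letter k) ∷ central k) (sym (not-involutive (letter k))))

central-prefix : ∀ {k m} → k < m → ∃[ r ] central m ≡ central k ++ not (letter k) ∷ r
central-prefix {k} {suc m} (s≤s k≤m) with m≤n⇒m<n∨m≡n k≤m
... | inj₂ refl = central-prefix-suc k
... | inj₁ k<m with central-prefix k<m | central-prefix-suc m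
...   | r , central-m | r′ , central-suc-m = r ++ not (letter m) ∷ r′ , (begin
  central (suc m)                                               ≡⟨ central-suc-m ⟩
  central m ++ not (letter m) ∷ r′                              ≡⟨ cong (_++ not (letter m) ∷ r′) central-m ⟩
  (central k ++ not (letter k) ∷ r) ++ not (letter m) ∷ r′      ≡⟨ ++-assoc (central k) _ _ ⟩
  central k ++ not (letter k) ∷ r ++ not (letter m) ∷ r′        ∎)
  where open ≡-Reasoning

length-∷ʳ : ∀ (xs : Word) x → length (xs ∷ʳ x) ≡ suc (length xs)
length-∷ʳ xs x = trans (length-++ xs) (+-comm (length xs) 1)

last-∷ʳ : ∀ (xs : Word) x → last (xs ∷ʳ x) ≡ just x
last-∷ʳ []           x = refl
last-∷ʳ (_ ∷ [])     x = refl
last-∷ʳ (_ ∷ y ∷ xs) x = last-∷ʳ (y ∷ xs) x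

last-reverse-∷ : ∀ x (xs : Word) → last (reverse (x ∷ xs)) ≡ just x
last-reverse-∷ x xs = trans (cong last (unfold-reverse x xs)) (last-∷ʳ (reverse xs) x)

reverse-∷-head : ∀ {x e} (xs : Word) → reverse (x ∷ xs) ≡ e ∷ xs → x ≡ e
reverse-∷-head []       eq = ∷-injectiveˡ eq
reverse-∷-head {x} {e} (y ∷ xs) eq = just-injective (begin
  just x                      ≡⟨ last-reverse-∷ x (y ∷ xs) ⟨
  last (reverse (x ∷ y ∷ xs)) ≡⟨ cong last eq ⟩
  last (x ∷ y ∷ xs)           ≡⟨ cong last (reverse-selfInverse {x = x ∷ y ∷ xs} eq) ⟨
  last (reverse (e ∷ y ∷ xs)) ≡⟨ last-reverse-∷ e (y ∷ xs) ⟩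
  just e                      ∎)
  where open ≡-Reasoning

x≢not-x : ∀ {x} → x ≢ not x
x≢not-x = not-¬ refl

take-suc-length : ∀ (xs : Word) y ys → take (suc (length xs)) (xs ++ y ∷ ys) ≡ xs ∷ʳ y
take-suc-length []       y ys = refl
take-suc-length (x ∷ xs) y ys = cong (x ∷_) (take-suc-length xs y ys)

take-drop-++ : ∀ {k n} (xs ys : Word) → k + n ≤ length xs → take n (drop k (xs ++ ys)) ≡ take n (drop k xs)
take-drop-++ {zero}  xs       ys n≤xs       = take-++-≤ xs ys n≤xs
take-drop-++ {suc k} (x ∷ xs) ys (s≤s k+n≤xs) = take-drop-++ xs ys k+n≤xs

length-bracket : ∀ x q → length (bracket x q) ≡ 2 + length q
length-bracket x q = cong suc (length-∷ʳ q x)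

take-bracket-extension : ∀ x e q r → take (2 + length q) (bracket e (q ++ not x ∷ r)) ≡ e ∷ (q ∷ʳ not x)
take-bracket-extension x e q r = cong (e ∷_)
  (trans (cong (take (suc (length q))) (++-assoc q (not x ∷ r) (e ∷ []))) (take-suc-length q (not x) (r ∷ʳ e)))

last-≢-∷ʳ-not : ∀ {x} (w : Word) e q → last w ≡ just x → w ≢ e ∷ (q ∷ʳ not x)
last-≢-∷ʳ-not w e q last-w eq =
  x≢not-x (just-injective (trans (sym last-w) (trans (cong last eq) (last-∷ʳ (e ∷ q) _))))

bracket-mirrored⇒equal : ∀ x e q r {ℓ} → ℓ ≤ length (bracket x q) →
                         Mirrored (bracket x q) (bracket e (q ++ not x ∷ r)) ℓ →
                         take ℓ (bracket x q) ≡ take ℓ (bracket e (q ++ not x ∷ r))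
bracket-mirrored⇒equal x e q r {zero}  _        _ = refl
bracket-mirrored⇒equal x e q r {suc ℓ} (s≤s ℓ≤) mirrored
  with m≤n⇒m<n∨m≡n (subst (ℓ ≤_) (length-∷ʳ q x) ℓ≤)
... | inj₁ (s≤s ℓ≤q) = cong₂ _∷_ (reverse-∷-head (take ℓ q) mirrored′) (trans inner-u (sym inner-v))
  where
  inner-u : take ℓ (q ∷ʳ x) ≡ take ℓ q
  inner-u = take-++-≤ q _ ℓ≤q
  inner-v : take ℓ ((q ++ not x ∷ r) ∷ʳ e) ≡ take ℓ q
  inner-v = trans (cong (take ℓ) (++-assoc q _ _)) (take-++-≤ q _ ℓ≤q)
  mirrored′ : reverse (x ∷ take ℓ q) ≡ e ∷ take ℓ q
  mirrored′ = trans (cong (λ w → reverse (x ∷ w)) (sym inner-u)) (trans mirrored (cong (e ∷_) inner-v))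
... | inj₂ refl = ⊥-elim (last-≢-∷ʳ-not (reverse (bracket x q)) e q (last-reverse-∷ x (q ∷ʳ x))
  (trans (cong (λ w → reverse (x ∷ w)) (sym (take-suc-length q x [])))
         (trans mirrored (take-bracket-extension x e q r))))

Factor : Word → Word → Set
Factor x w = ∃[ a ] ∃[ b ] w ≡ a ++ x ++ b

Factor-++ʳ : ∀ {x w} w′ → Factor x w → Factor x (w ++ w′)
Factor-++ʳ {x} w′ (a , b , refl) =
  a , b ++ w′ , trans (++-assoc a (x ++ b) w′) (cong (a ++_) (++-assoc x b w′))

take-drop-Factor : ∀ n k (w : Word) → Factor (take n (drop k w)) w
take-drop-Factor n k w = take k w , drop n (drop k w) ,
  trans (sym (take++drop≡id k w)) (cong (take k w ++_) (sym (take++drop≡id n (drop k w))))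

Factor-length : ∀ {x w} → Factor x w → length x ≤ length w
Factor-length {x} (a , b , refl) = ≤-trans (length-++-≤ˡ x) (length-++-≤ʳ (x ++ b) {a})

bracket-no-early-occurrence : ∀ x e q r → (Factor (bracket x q) (q ++ not x ∷ r) → ⊥) →
                              NoEarlyOccurrence (bracket x q) (bracket e (q ++ not x ∷ r))
bracket-no-early-occurrence x e q r _ zero _ at-start =
  last-≢-∷ʳ-not (bracket x q) e q (last-∷ʳ (x ∷ q) x) (trans (sym at-start)
    (trans (cong (λ n → take n (bracket e (q ++ not x ∷ r))) (length-bracket x q))
           (take-bracket-extension x e q r)))
bracket-no-early-occurrence x e q r not-factor (suc k) early occurrence =
  not-factor (subst (λ y → Factor y body) inside (take-drop-Factor (length (bracket x q)) k body))
  where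
  body : Word
  body = q ++ not x ∷ r
  within : k + length (bracket x q) ≤ length body
  within = s≤s⁻¹ (s≤s⁻¹ (subst (suc k + length (bracket x q) <_) (length-bracket e body) early))
  inside : take (length (bracket x q)) (drop k body) ≡ bracket x q
  inside = trans (sym (take-drop-++ body (e ∷ []) within)) occurrence

-- Desubstitution and the forbidden factors

φ-head : ∀ w {r} → φ w ≢ true ∷ r
φ-head []          ()
φ-head (false ∷ w) ()
φ-head (true ∷ w)  ()

φ-∷-++ : ∀ z y b → ∃[ r ] φ (z ∷ y) ++ b ≡ false ∷ r
φ-∷-++ false y b = _ , refl
φ-∷-++ true  y b = _ , refl

φ-one⁻ : ∀ w a {r} → φ w ≡ a ++ true ∷ r → ∃[ a′ ] a ≡ a′ ∷ʳ false
φ-one⁻ []          []          ()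
φ-one⁻ []          (_ ∷ _)     ()
φ-one⁻ (false ∷ w) []          ()
φ-one⁻ (false ∷ w) (x ∷ [])    refl = [] , refl
φ-one⁻ (false ∷ w) (x ∷ y ∷ a) eq with φ-one⁻ w a (∷-injectiveʳ (∷-injectiveʳ eq))
... | a′ , refl = x ∷ y ∷ a′ , refl
φ-one⁻ (true ∷ w)  []          ()
φ-one⁻ (true ∷ w)  (x ∷ a)     eq with φ-one⁻ w a (∷-injectiveʳ eq)
... | a′ , refl = x ∷ a′ , refl

φ-zero⁻ : ∀ w a {r} → φ w ≡ a ++ false ∷ r →
          ∃[ w₁ ] ∃[ w₂ ] w ≡ w₁ ++ w₂ × φ w₂ ≡ false ∷ r
φ-zero⁻ w           []          eq = [] , w , refl , eq
φ-zero⁻ []          (_ ∷ _)     ()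
φ-zero⁻ (false ∷ w) (x ∷ [])    ()
φ-zero⁻ (false ∷ w) (x ∷ y ∷ a) eq with φ-zero⁻ w a (∷-injectiveʳ (∷-injectiveʳ eq))
... | w₁ , w₂ , refl , φw₂ = false ∷ w₁ , w₂ , refl , φw₂
φ-zero⁻ (true ∷ w)  (x ∷ a)     eq with φ-zero⁻ w a (∷-injectiveʳ eq)
... | w₁ , w₂ , refl , φw₂ = true ∷ w₁ , w₂ , refl , φw₂

-- φ 1 = 0 is a prefix of φ 0 = 01, so φ y inside a φ-image desubstitutes to y only when it is
-- followed by a 0 or y ends with 0.
Synchronised : Word → Word → Set
Synchronised y b = (∃[ b′ ] b ≡ false ∷ b′) ⊎ (∃[ y′ ] y ≡ y′ ∷ʳ false)

Synchronised-tail : ∀ {x z y b} → Synchronised (x ∷ z ∷ y) b → Synchronised (z ∷ y) b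
Synchronised-tail (inj₁ b-starts)          = inj₁ b-starts
Synchronised-tail (inj₂ ([] , ()))
Synchronised-tail (inj₂ (_ ∷ y′ , y-ends)) = inj₂ (y′ , ∷-injectiveʳ y-ends)

φ-prefix⁻ : ∀ y w b → Synchronised y b → φ w ≡ φ y ++ b → ∃[ b′ ] w ≡ y ++ b′
φ-prefix⁻ []                w           b _    _  = w , refl
φ-prefix⁻ (false ∷ [])      (false ∷ w) b _    _  = w , refl
φ-prefix⁻ (true ∷ [])       (true ∷ w)  b _    _  = w , refl
φ-prefix⁻ (true ∷ [])       (false ∷ w) b (inj₁ (_ , refl)) ()
φ-prefix⁻ (true ∷ [])       (false ∷ w) b (inj₂ (y′ , ends)) _ =
  ⊥-elim (x≢not-x (∷ʳ-injectiveʳ [] y′ ends))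
φ-prefix⁻ (false ∷ z ∷ y)   (false ∷ w) b sync eq
  with φ-prefix⁻ (z ∷ y) w b (Synchronised-tail sync) (∷-injectiveʳ (∷-injectiveʳ eq))
... | b′ , refl = b′ , refl
φ-prefix⁻ (true ∷ z ∷ y)    (true ∷ w)  b sync eq
  with φ-prefix⁻ (z ∷ y) w b (Synchronised-tail sync) (∷-injectiveʳ eq)
... | b′ , refl = b′ , refl
φ-prefix⁻ (true ∷ false ∷ y) (false ∷ w) b _   ()
φ-prefix⁻ (true ∷ true ∷ y) (false ∷ w) b _    ()
φ-prefix⁻ (false ∷ y)       (true ∷ w)  b _    eq = ⊥-elim (φ-head w (∷-injectiveʳ eq))
φ-prefix⁻ (false ∷ y)       []          b _    ()
φ-prefix⁻ (true ∷ y)        []          b _    ()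

φ-factor⁻ : ∀ w a z y b → Synchronised (z ∷ y) b → φ w ≡ a ++ φ (z ∷ y) ++ b → Factor (z ∷ y) w
φ-factor⁻ w a z y b sync eq with φ-∷-++ z y b
... | r , starts with φ-zero⁻ w a (trans eq (cong (a ++_) starts))
...   | w₁ , w₂ , refl , φw₂ with φ-prefix⁻ (z ∷ y) w₂ b sync (trans φw₂ (sym starts))
...     | b′ , refl = w₁ , b′ , refl

-- Up to an end letter, M_{n+1} is the φ-image of M_n.
φ-avoids-bracket : ∀ x q W → (Factor (bracket x q) W → ⊥) →
                   Factor (bracket (not x) (φ q ∷ʳ false)) (φ W) → ⊥
φ-avoids-bracket true q W avoids (a , b , eq) =
  avoids (φ-factor⁻ W a true (q ∷ʳ true) (false ∷ b) (inj₁ (b , refl)) (trans eq (cong (a ++_) image)))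
  where
  open ≡-Reasoning
  image : bracket false (φ q ∷ʳ false) ++ b ≡ φ (bracket true q) ++ false ∷ b
  image = begin
    false ∷ ((φ q ∷ʳ false) ∷ʳ false) ++ b
      ≡⟨ cong (false ∷_) (++-assoc (φ q ∷ʳ false) (false ∷ []) b) ⟩
    false ∷ (φ q ∷ʳ false) ++ false ∷ b
      ≡⟨ cong (λ w → false ∷ w ++ false ∷ b) (φ-++ q (true ∷ [])) ⟨
    φ (bracket true q) ++ false ∷ b       ∎
φ-avoids-bracket false q W avoids (a , b , eq) with φ-one⁻ W a eq
... | a′ , refl = avoids (φ-factor⁻ W a′ false (q ∷ʳ false) b (inj₂ (false ∷ q , refl)) (trans eq image))
  where
  open ≡-Reasoning
  φ-snoc-false : (φ q ∷ʳ false) ∷ʳ true ≡ φ (q ∷ʳ false)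
  φ-snoc-false = trans (++-assoc (φ q) (false ∷ []) (true ∷ [])) (sym (φ-++ q (false ∷ [])))
  image : (a′ ∷ʳ false) ++ bracket true (φ q ∷ʳ false) ++ b ≡ a′ ++ φ (bracket false q) ++ b
  image = begin
    (a′ ∷ʳ false) ++ true ∷ ((φ q ∷ʳ false) ∷ʳ true) ++ b ≡⟨ ∷ʳ-++ a′ false _ ⟩
    a′ ++ false ∷ true ∷ ((φ q ∷ʳ false) ∷ʳ true) ++ b    ≡⟨ cong (λ w → a′ ++ false ∷ true ∷ w ++ b) φ-snoc-false ⟩
    a′ ++ φ (bracket false q) ++ b                        ∎

bracket-not-factor-short : ∀ x q {w} → length w < 2 → Factor (bracket x q) w → ⊥
bracket-not-factor-short x q {w} w<2 f =
  <⇒≱ w<2 (≤-trans (m≤m+n 2 (length q)) (subst (_≤ length w) (length-bracket x q) (Factor-length f)))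

bracket-not-factor-fib : ∀ k m → Factor (bracket (letter k) (central k)) (fib m) → ⊥
bracket-not-factor-fib k zero          = bracket-not-factor-short (letter k) (central k) z<s
bracket-not-factor-fib k (suc zero)    = bracket-not-factor-short (letter k) (central k) (s<s z<s)
-- M_3 = 11, while every 1 of a φ-image follows a 0.
bracket-not-factor-fib zero (suc (suc m)) (a , b , eq)
  with φ-one⁻ (fib (1 + m)) (a ∷ʳ true) (trans (sym (fib-φ m)) (trans eq (sym (∷ʳ-++ a true _))))
... | a′ , ends = x≢not-x (∷ʳ-injectiveʳ a a′ ends)
bracket-not-factor-fib (suc k) (suc (suc m)) f =
  φ-avoids-bracket (letter k) (central k) (fib (1 + m)) (bracket-not-factor-fib k (suc m))
    (subst (Factor _) (fib-φ m) f)

bracket-correlation : ∀ x e q r → IsPalindrome q → IsPalindrome (q ++ not x ∷ r) →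
                      (Factor (bracket x q) (q ++ not x ∷ r) → ⊥) →
                      CorrelationsMatchCommonBorders (bracket x q) (bracket e (q ++ not x ∷ r))
bracket-correlation x e q r q-pal body-pal not-factor =
  palindrome-correlation (bracket-palindrome x q-pal) (bracket-palindrome e body-pal) shorter
    (bracket-mirrored⇒equal x e q r) (bracket-no-early-occurrence x e q r not-factor)
  where
  shorter : length (bracket x q) ≤ length (bracket e (q ++ not x ∷ r))
  shorter = subst₂ _≤_ (sym (length-bracket x q)) (sym (length-bracket e (q ++ not x ∷ r)))
                    (s≤s (s≤s (length-++-≤ˡ q)))

bracket-central-correlation : ∀ {k m} → k ≤ m →
  CorrelationsMatchCommonBorders (bracket (letter k) (central k)) (bracket (letter m) (central m))
bracket-central-correlation {k} {m} k≤m with m≤n⇒m<n∨m≡n k≤m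
... | inj₂ refl = palindrome-correlation pal pal ≤-refl (λ _ _ → refl) (λ j early _ → m+n≮n j _ early)
  where
  pal : IsPalindrome (bracket (letter k) (central k))
  pal = bracket-palindrome (letter k) (proj₁ (central-palindrome k))
... | inj₁ k<m with central-prefix k<m
...   | r , central-m =
  subst (CorrelationsMatchCommonBorders (bracket (letter k) (central k)) ∘ bracket (letter m)) (sym central-m)
    (bracket-correlation (letter k) (letter m) (central k) r (proj₁ (central-palindrome k))
      (subst IsPalindrome central-m (proj₁ (central-palindrome m))) not-factor)
  where
  not-factor : Factor (bracket (letter k) (central k)) (central k ++ not (letter k) ∷ r) → ⊥
  not-factor f = bracket-not-factor-fib k (3 + m)
    (subst (Factor _) (sym (fib≡central m)) (Factor-++ʳ _ (subst (Factor _) (sym central-m) f)))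

theorem4 : (n m : ℕ) → 3 ≤ n → n ≤ m →
    ((d : ℕ) → corrPoly (M n) (M m) d ≡ borderSumPoly (Bcap n m) d) ×
    ((d : ℕ) → corrPoly (M m) (M n) d ≡ borderSumPoly (Bcap n m) d)
theorem4 (suc (suc (suc k))) (suc (suc (suc m))) (s≤s (s≤s (s≤s _))) (s≤s (s≤s (s≤s k≤m))) =
  subst₂ CorrelationsMatchCommonBorders (sym (M≡bracket k)) (sym (M≡bracket m))
    (bracket-central-correlation k≤m)
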